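{- (a) For all $p=2^n\ge 8$ and all $i,j\in\{1,\dots,p/2\}$: $M_{p/2}[i,j]=M_p[i,j]=M_p[i+p/2,j+p/2]$ and $M_{p/2}^*[i,j]=M_p^*[i,j]=M_p^*[i+p/2,j+p/2]$. (b) For all distinct $i,j\in\{1,2,3,4\}$: $M_8[i,j]=-M_8[i,j+4]=-M_8[i+4,j]$ and $M_8^*[i,j]=-M_8^*[i,j+4]=-M_8^*[i+4,j]$. (c) For all $p=2^n\ge 16$ and all distinct $i,j\in\{1,\dots,p/2\}$: $M_p[i,j]=\pm M_p[i,j+p/2]=\pm M_p[i+p/2,j]$ and $M_p^*[i,j]=\pm M_p^*[i,j+p/2]=\pm M_p^*[i+p/2,j]$, where the sign is $+$ except when $|j-i|=p/4$, in which case it is $-$. (d) For all $p=2^n\ge 8$ and all $i\in\{1,\dots,p/2\}$: $M_p[i,i+p/2]=M_p^*[i+p/2,i]=n+1$ and $M_p[i+p/2,i]=M_p^*[i,i+p/2]=-(n+1)$.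
   Context: Throughout, $p = 2^n$ with $n \ge 2$. The $4\times 4$ matrices $M_4$ and $M_4^*$ are, row by row, $M_4$: $(0,1,2,3)$, $(-1,0,3,-2)$, $(-2,-3,0,1)$, $(-3,2,-1,0)$; $M_4^*$: $(0,-2,-3,-1)$, $(2,0,1,-3)$, $(3,-1,0,2)$, $(1,3,-2,0)$. For $p = 2^n \ge 8$, $M_p$ and $M_p^*$ are $p\times p$ matrices consisting of a $(p/4)\times(p/4)$ array of $4\times 4$ blocks; with $I$ the $4\times 4$ identity and $1\le a,b\le p/4$ block indices, block $(a,b)$ of $M_p$ is: $M_4$ if $b-a=0$; $-M_4+4I$ if $b-a\equiv 1 \pmod 4$; $-M_4-4I$ if $b-a\equiv -1\pmod 4$; $M_4+(x+4)I$ if $b-a = y\cdot 2^x$ with $x\ge 1$ and $y\equiv 1\pmod 4$; $M_4-(x+4)I$ if $b-a=y\cdot 2^x$ with $x\ge1$ and $y\equiv -1\pmod 4$. Block $(a,b)$ of $M_p^*$ is: $M_4^*$ if $b-a=0$; $-M_4^*-4I$ if $b-a\equiv 1\pmod 4$; $-M_4^*+4I$ if $b-a\equiv -1\pmod 4$; $M_4^*-(x+4)I$ if $b-a=y\cdot 2^x$ with $x\ge1$, $y\equiv 1\pmod 4$; $M_4^*+(x+4)I$ if $b-a=y\cdot 2^x$ with $x\ge 1$, $y\equiv -1\pmod 4$. -}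

module Defs where

open import Data.Nat as ℕ using (ℕ; zero; suc; _∸_; _^_; _<?_)
open import Data.Nat.DivMod using (_/_; _%_; _mod_)
open import Data.Integer as ℤ using (ℤ; +_; -[1+_]; -_; _+_; _*_; _-_)
open import Data.Fin as Fin using (Fin; fromℕ<)
open import Data.Vec using (Vec; []; _∷_; lookup)
open import Data.Product using (_×_; _,_)
open import Data.Bool using (Bool; true; false; if_then_else_)
open import Relation.Nullary using (yes; no; does)

M4 : Fin 4 → Fin 4 → ℤ
M4 r s = lookup (lookup rows r) s
  where
  rows : Vec (Vec ℤ 4) 4
  rows = (+ 0 ∷ + 1 ∷ + 2 ∷ + 3 ∷ [])
       ∷ (- + 1 ∷ + 0 ∷ + 3 ∷ - + 2 ∷ [])
       ∷ (- + 2 ∷ - + 3 ∷ + 0 ∷ + 1 ∷ [])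
       ∷ (- + 3 ∷ + 2 ∷ - + 1 ∷ + 0 ∷ [])
       ∷ []

M4* : Fin 4 → Fin 4 → ℤ
M4* r s = lookup (lookup rows r) s
  where
  rows : Vec (Vec ℤ 4) 4
  rows = (+ 0 ∷ - + 2 ∷ - + 3 ∷ - + 1 ∷ [])
       ∷ (+ 2 ∷ + 0 ∷ + 1 ∷ - + 3 ∷ [])
       ∷ (+ 3 ∷ - + 1 ∷ + 0 ∷ + 2 ∷ [])
       ∷ (+ 1 ∷ + 3 ∷ - + 2 ∷ + 0 ∷ [])
       ∷ []

-- 2-adic decomposition of a positive natural m = y * 2^x with y odd,
-- computed with fuel (call with fuel m).  Returns (x , y).
v2 : ℕ → ℕ → ℕ × ℕ
v2 zero    m = 0 , m
v2 (suc f) m with m % 2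
... | zero  with v2 f (m / 2)
...   | x , y = suc x , y
v2 (suc f) m | suc _ = 0 , m

-- Classification of a block offset d = b - a ∈ ℤ as in the definition:
--   same      : d = 0
--   odd  ε    : d odd, d ≡ 1 (mod 4) if ε = true, d ≡ -1 (mod 4) if ε = false
--   even x ε  : d = y·2^x with x ≥ 1, y ≡ 1 (mod 4) if ε = true, y ≡ -1 if false
data DiffClass : Set where
  same : DiffClass
  odd  : Bool → DiffClass
  even : ℕ → Bool → DiffClass

-- m > 0 with sign; `pos` says whether d = m or d = -m.
classifyAbs : Bool → ℕ → DiffClass
classifyAbs pos m with v2 m m
... | x , y = build x (residueIsOne pos (y % 4))
  where
  residueIsOne : Bool → ℕ → Bool
  residueIsOne true  1 = true
  residueIsOne false 3 = true   -- -y ≡ 1 (mod 4) iff y ≡ 3 (mod 4)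
  residueIsOne _     _ = false
  build : ℕ → Bool → DiffClass
  build zero    e = odd e
  build (suc k) e = even (suc k) e

classify : ℤ → DiffClass
classify (+ zero)    = same
classify (+ (suc k)) = classifyAbs true (suc k)
classify -[1+ k ]    = classifyAbs false (suc k)

-- A block is  ε·B + c·I  (B = M₄ or M₄*); we record (ε , c).
blockM : DiffClass → ℤ × ℤ
blockM same         = + 1 , + 0
blockM (odd true)   = - + 1 , + 4
blockM (odd false)  = - + 1 , - + 4
blockM (even x true)  = + 1 , + (x ℕ.+ 4)
blockM (even x false) = + 1 , - + (x ℕ.+ 4)

blockM* : DiffClass → ℤ × ℤ
blockM* same         = + 1 , + 0
blockM* (odd true)   = - + 1 , - + 4
blockM* (odd false)  = - + 1 , + 4
blockM* (even x true)  = + 1 , - + (x ℕ.+ 4)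
blockM* (even x false) = + 1 , + (x ℕ.+ 4)

blockEntry : (Fin 4 → Fin 4 → ℤ) → (DiffClass → ℤ × ℤ) → ℕ → ℕ → ℤ
blockEntry B sel i j with sel (classify (+ (j / 4) - + (i / 4)))
... | ε , c = ε * B r s + (if does (r Fin.≟ s) then c else + 0)
  where
  r = i mod 4
  s = j mod 4

-- M_p and M_p* for p = 2^n as p×p matrices (0-based Fin indices).
-- (Meaningful for n ≥ 2; for n = 2 there is a single diagonal block, so
-- M 2 = M₄ and M* 2 = M₄*.)
M : (n : ℕ) → Fin (2 ^ n) → Fin (2 ^ n) → ℤ
M n i j = blockEntry M4 blockM (Fin.toℕ i) (Fin.toℕ j)

M* : (n : ℕ) → Fin (2 ^ n) → Fin (2 ^ n) → ℤ
M* n i j = blockEntry M4* blockM* (Fin.toℕ i) (Fin.toℕ j)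

-- 1-based entry access  A [ i , j ]  for a p×p matrix; returns 0 outside
-- 1..p (only ever used under range hypotheses).
_[_,_] : ∀ {p} → (Fin p → Fin p → ℤ) → ℕ → ℕ → ℤ
_[_,_] {p} A i j with (i ∸ 1) <? p | (j ∸ 1) <? p
... | yes i<p | yes j<p = A (fromℕ< i<p) (fromℕ< j<p)
... | _       | _       = + 0

-- An entry of M_p (or M_p^*) depends only on its position (r, s) inside its 4×4 block and,
-- through the block ε·B + c·I, on the class of the block offset d = ⌊j/4⌋ − ⌊i/4⌋, which
-- records the 2-adic valuation of d and the residue mod 4 of its odd part.  Moving one
-- index by p/2 shifts d by ±K with K = 2^(n−3).  If |d| < K, d ≠ 0 and |d| ≠ K/2, the
-- valuation of d is below that of K/2, so the odd part changes by a multiple of 4 and the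
-- class is unchanged.  If |d| = K/2 the residue of the odd part flips, which keeps ε and
-- negates c; if d = 0 the new class is even, again with ε = 1.  Off the block diagonal only
-- ε matters and on it only c, and |j − i| = p/4 exactly when r = s and |d| = K/2; this is (c).
-- Shifting both indices keeps d, giving (a).  In (d) we have r = s and d = ±K, and the
-- class of ±2^(n−3) has c = ±(n + 1).  Part (b) is a finite computation.
module Submission where

open import Defs
open import Data.Bool using (Bool; true; false; not; if_then_else_)
open import Data.Bool.Properties using (not-involutive)
open import Data.Empty using (⊥-elim)
open import Data.Fin as Fin using (Fin)
open import Data.Fin.Properties using (toℕ-fromℕ<; fromℕ<-cong)
open import Data.Integer as ℤ using (ℤ; +_; -[1+_]; -_; 0ℤ; ∣_∣; _⊖_)
import Data.Integer.Properties as ℤ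
import Data.Integer.Tactic.RingSolver as ℤ-Solver
open import Data.Nat as ℕ using (ℕ; zero; suc; _+_; _*_; _^_; _∸_; _<_; _≤_; _⊔_; s≤s; z≤n)
open import Data.Nat.Divisibility using (divides-refl)
open import Data.Nat.DivMod
open import Data.Nat.Induction using (<-rec)
open import Data.Nat.Properties
open import Data.Nat.Tactic.RingSolver using (solve-∀)
open import Data.Product using (_×_; _,_; proj₁; proj₂; ∃-syntax)
open import Data.Sum using (inj₁; inj₂)
open import Function using (_∘_)
open import Relation.Binary.PropositionalEquality hiding ([_])
open import Relation.Nullary using (Dec; yes; no; does)

-- 2-adic form of block offsets

-- The odd numbers ≡ 1 and ≡ 3 (mod 4) are oddRes true + 4q and oddRes false + 4q;
-- dyadicClass x t is the class Defs.classify gives to 2^x (oddRes t + 4q), q ∈ ℤ.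
oddRes : Bool → ℕ
oddRes true  = 1
oddRes false = 3

dyadicClass : ℕ → Bool → DiffClass
dyadicClass zero    t = odd t
dyadicClass (suc x) t = even (suc x) t

dyadic : ℕ → Bool → ℕ → ℕ
dyadic x t q = 2 ^ x * (oddRes t + q * 4)

Dyadic : ℕ → Set
Dyadic e = ∃[ x ] ∃[ t ] ∃[ q ] e ≡ dyadic x t q

oddRes+4q%4 : ∀ t q → (oddRes t + q * 4) % 4 ≡ oddRes t
oddRes+4q%4 true  q = [m+kn]%n≡m%n 1 q 4
oddRes+4q%4 false q = [m+kn]%n≡m%n 3 q 4

oddRes+4q%2 : ∀ t q → (oddRes t + q * 4) % 2 ≡ 1
oddRes+4q%2 t q = trans (cong (λ k → (oddRes t + k) % 2) (sym (*-assoc q 2 2))) (odd-residue t)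
  where
  odd-residue : ∀ t → (oddRes t + q * 2 * 2) % 2 ≡ 1
  odd-residue true  = [m+kn]%n≡m%n 1 (q * 2) 2
  odd-residue false = [m+kn]%n≡m%n 3 (q * 2) 2

n<2^n : ∀ n → n < 2 ^ n
n<2^n zero    = s≤s z≤n
n<2^n (suc n) = begin-strict
  suc n         ≤⟨ n<2^n n ⟩
  2 ^ n         <⟨ m<m+n (2 ^ n) (m^n>0 2 n) ⟩
  2 ^ n + 2 ^ n ≡⟨ cong (λ k → 2 ^ n + k) (+-identityʳ (2 ^ n)) ⟨
  2 ^ suc n     ∎
  where open ≤-Reasoning

2^x≤dyadic : ∀ x t q → 2 ^ x ≤ dyadic x t q
2^x≤dyadic x true  q = m≤m*n (2 ^ x) (oddRes true + q * 4)
2^x≤dyadic x false q = m≤m*n (2 ^ x) (oddRes false + q * 4)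

0<dyadic : ∀ x t q → 0 < dyadic x t q
0<dyadic x t q = <-≤-trans (m^n>0 2 x) (2^x≤dyadic x t q)

v2-double : ∀ f m → v2 (suc f) (m * 2) ≡ (suc (proj₁ (v2 f m)) , proj₂ (v2 f m))
v2-double f m with m*2%2 ← m*n%n≡0 m 2 | m*2/2 ← m*n/n≡m m 2 rewrite m*2%2 | m*2/2 = refl

v2-2^x*odd : ∀ x y {f} → y % 2 ≡ 1 → x < f → v2 f (2 ^ x * y) ≡ (x , y)
v2-2^x*odd zero    y {suc f} y-odd _ rewrite *-identityˡ y | y-odd = refl
v2-2^x*odd (suc x) y {suc f} y-odd (s≤s x<f)
  rewrite *-assoc 2 (2 ^ x) y | *-comm 2 (2 ^ x * y) | v2-double f (2 ^ x * y) | v2-2^x*odd x y y-odd x<f = refl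

classifyAbs-dyadic : ∀ pos x t q → classifyAbs pos (dyadic x t q) ≡ dyadicClass x (if pos then t else not t)
classifyAbs-dyadic pos x t q
  with v2 (dyadic x t q) (dyadic x t q)
     | v2-2^x*odd x (oddRes t + q * 4) (oddRes+4q%2 t q) (<-≤-trans (n<2^n x) (2^x≤dyadic x t q))
... | _ | refl rewrite oddRes+4q%4 t q with pos | t | x
... | true  | true  | zero  = refl
... | true  | true  | suc _ = refl
... | true  | false | zero  = refl
... | true  | false | suc _ = refl
... | false | true  | zero  = refl
... | false | true  | suc _ = refl
... | false | false | zero  = refl
... | false | false | suc _ = refl

dyadic-double : ∀ {e} → Dyadic e → Dyadic (2 * e)
dyadic-double (x , t , q , refl) = suc x , t , q , sym (*-assoc 2 (2 ^ x) _)

dyadic-decomposition : ∀ e → 0 < e → Dyadic e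
dyadic-decomposition = <-rec (λ e → 0 < e → Dyadic e) step
  where
  Rec : ℕ → Set
  Rec e = ∀ {e′} → e′ < e → 0 < e′ → Dyadic e′
  viaHalf : ∀ e h → e ≡ 2 * h → Rec e → 0 < e → Dyadic e
  viaHalf _ (suc h) refl rec _ = dyadic-double (rec (m<m+n (suc h) (s≤s z≤n)) (s≤s z≤n))
  step : ∀ e → Rec e → 0 < e → Dyadic e
  step e rec 0<e with e % 4 | m≡m%n+[m/n]*n e 4 | m%n<n e 4
  ... | 0 | e≡ | _ = viaHalf e (e / 4 * 2) (trans e≡ (regroup (e / 4))) rec 0<e
    where
    regroup : ∀ q → 0 + q * 4 ≡ 2 * (q * 2)
    regroup = solve-∀
  ... | 1 | e≡ | _ = 0 , true , e / 4 , trans e≡ (sym (*-identityˡ _))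
  ... | 2 | e≡ | _ = viaHalf e (1 + e / 4 * 2) (trans e≡ (regroup (e / 4))) rec 0<e
    where
    regroup : ∀ q → 2 + q * 4 ≡ 2 * (1 + q * 2)
    regroup = solve-∀
  ... | 3 | e≡ | _ = 0 , false , e / 4 , trans e≡ (sym (*-identityˡ _))
  ... | suc (suc (suc (suc _))) | _ | s≤s (s≤s (s≤s (s≤s ())))

valuation< : ∀ {m} x t q → dyadic x t q < 2 ^ suc m → dyadic x t q ≢ 2 ^ m → x < m
valuation< {m} x t q d<2^[1+m] d≢2^m with m≤n⇒m<n∨m≡n x≤m
  where
  x≤m : x ≤ m
  x≤m = m<1+n⇒m≤n (≰⇒> λ 1+m≤x → <⇒≱ d<2^[1+m] (≤-trans (^-monoʳ-≤ 2 1+m≤x) (2^x≤dyadic x t q)))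
... | inj₁ x<m  = x<m
... | inj₂ refl = ⊥-elim (d≢2^m (unit-odd-part t q odd-part<2))
  where
  odd-part<2 : oddRes t + q * 4 < 2
  odd-part<2 = *-cancelˡ-< (2 ^ x) _ 2 (subst (dyadic x t q <_) (*-comm 2 (2 ^ x)) d<2^[1+m])
  unit-odd-part : ∀ t q → oddRes t + q * 4 < 2 → dyadic x t q ≡ 2 ^ x
  unit-odd-part true  zero    _ = *-identityʳ (2 ^ x)
  unit-odd-part true  (suc q) (s≤s (s≤s ()))
  unit-odd-part false q       (s≤s (s≤s ()))

oddℤ : Bool → ℤ → ℤ
oddℤ t q = + oddRes t ℤ.+ q ℤ.* + 4

dyadicℤ : ℕ → Bool → ℤ → ℤ
dyadicℤ x t q = + 2 ^ x ℤ.* oddℤ t q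

+dyadic : ∀ x t q → + dyadic x t q ≡ dyadicℤ x t (+ q)
+dyadic x t q = begin
  + (2 ^ x * (oddRes t + q * 4))           ≡⟨ ℤ.pos-* (2 ^ x) _ ⟩
  + 2 ^ x ℤ.* + (oddRes t + q * 4)         ≡⟨ cong (λ k → + 2 ^ x ℤ.* k) (ℤ.pos-+ (oddRes t) (q * 4)) ⟩
  + 2 ^ x ℤ.* (+ oddRes t ℤ.+ + (q * 4))   ≡⟨ cong (λ k → + 2 ^ x ℤ.* (+ oddRes t ℤ.+ k)) (ℤ.pos-* q 4) ⟩
  dyadicℤ x t (+ q)                        ∎
  where open ≡-Reasoning

-dyadic : ∀ x t q → - + dyadic x t q ≡ dyadicℤ x (not t) -[1+ q ]
-dyadic x t q rewrite +dyadic x t q = negate t (+ 2 ^ x) (+ q)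
  where
  negate : ∀ t A Q → - (A ℤ.* (+ oddRes t ℤ.+ Q ℤ.* + 4)) ≡ A ℤ.* (+ oddRes (not t) ℤ.+ - (+ 1 ℤ.+ Q) ℤ.* + 4)
  negate true  = ℤ-Solver.solve-∀
  negate false = ℤ-Solver.solve-∀

classify-+ : ∀ {e} → 0 < e → classify (+ e) ≡ classifyAbs true e
classify-+ {suc e} _ = refl

classify-- : ∀ {e} → 0 < e → classify (- + e) ≡ classifyAbs false e
classify-- {suc e} _ = refl

classify-dyadicℤ : ∀ x t q → classify (dyadicℤ x t q) ≡ dyadicClass x t
classify-dyadicℤ x t (+ q) = begin
  classify (dyadicℤ x t (+ q))     ≡⟨ cong classify (+dyadic x t q) ⟨
  classify (+ dyadic x t q)        ≡⟨ classify-+ (0<dyadic x t q) ⟩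
  classifyAbs true (dyadic x t q)  ≡⟨ classifyAbs-dyadic true x t q ⟩
  dyadicClass x t                  ∎
  where open ≡-Reasoning
classify-dyadicℤ x t -[1+ q ] = begin
  classify (dyadicℤ x t -[1+ q ])             ≡⟨ cong (λ t′ → classify (dyadicℤ x t′ -[1+ q ])) (not-involutive t) ⟨
  classify (dyadicℤ x (not (not t)) -[1+ q ]) ≡⟨ cong classify (-dyadic x (not t) q) ⟨
  classify (- + dyadic x (not t) q)           ≡⟨ classify-- (0<dyadic x (not t) q) ⟩
  classifyAbs false (dyadic x (not t) q)      ≡⟨ classifyAbs-dyadic false x (not t) q ⟩
  dyadicClass x (not (not t))                 ≡⟨ cong (dyadicClass x) (not-involutive t) ⟩
  dyadicClass x t                             ∎
  where open ≡-Reasoning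

classify-pure-shift : ∀ x t q → classify (0ℤ ℤ.+ + 2 ^ x ℤ.* oddℤ t q) ≡ dyadicClass x t
classify-pure-shift x t q = trans (cong classify (ℤ.+-identityˡ (dyadicℤ x t q))) (classify-dyadicℤ x t q)

signed-dyadic : ∀ d x t q → ∣ d ∣ ≡ dyadic x t q → ∃[ t′ ] ∃[ q′ ] d ≡ dyadicℤ x t′ q′
signed-dyadic (+ _)    x t q refl = t , + q , +dyadic x t q
signed-dyadic -[1+ n ] x t q eq   = not t , -[1+ q ] , trans (cong (λ k → - + k) eq) (-dyadic x t q)

2^[1+x]≡2^x+2^x : ∀ x → 2 ^ suc x ≡ 2 ^ x + 2 ^ x
2^[1+x]≡2^x+2^x x = cong (λ k → 2 ^ x + k) (+-identityʳ (2 ^ x))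

2^[2+x]≡2^x*4 : ∀ x → 2 ^ (2 + x) ≡ 2 ^ x * 4
2^[2+x]≡2^x*4 x = regroup (2 ^ x)
  where
  regroup : ∀ A → 2 * (2 * A) ≡ A * 4
  regroup = solve-∀

classify-shift-dyadic-low : ∀ {m x} t q u → x < m →
  classify (dyadicℤ x t q ℤ.+ + 2 ^ suc m ℤ.* u) ≡ dyadicClass x t
classify-shift-dyadic-low {x = x} t q u (s≤s x≤m) with w , refl ← m≤n⇒∃[o]m+o≡n x≤m =
  trans (cong classify same-odd-residue) (classify-dyadicℤ x t (q ℤ.+ + 2 ^ w ℤ.* u))
  where
  K≡ : + 2 ^ (2 + (x + w)) ≡ + 2 ^ x ℤ.* (+ 2 ^ w ℤ.* + 4)
  K≡ = begin
    + 2 ^ (2 + (x + w))          ≡⟨ cong +_ (2^[2+x]≡2^x*4 (x + w)) ⟩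
    + (2 ^ (x + w) * 4)          ≡⟨ cong (λ k → + (k * 4)) (^-distribˡ-+-* 2 x w) ⟩
    + (2 ^ x * 2 ^ w * 4)        ≡⟨ cong +_ (*-assoc (2 ^ x) (2 ^ w) 4) ⟩
    + (2 ^ x * (2 ^ w * 4))      ≡⟨ trans (ℤ.pos-* (2 ^ x) _) (cong (λ k → + 2 ^ x ℤ.* k) (ℤ.pos-* (2 ^ w) 4)) ⟩
    + 2 ^ x ℤ.* (+ 2 ^ w ℤ.* + 4) ∎
    where open ≡-Reasoning
  regroup : ∀ A R Q W U → A ℤ.* (R ℤ.+ Q ℤ.* + 4) ℤ.+ A ℤ.* (W ℤ.* + 4) ℤ.* U ≡ A ℤ.* (R ℤ.+ (Q ℤ.+ W ℤ.* U) ℤ.* + 4)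
  regroup = ℤ-Solver.solve-∀
  same-odd-residue : dyadicℤ x t q ℤ.+ + 2 ^ (2 + (x + w)) ℤ.* u ≡ dyadicℤ x t (q ℤ.+ + 2 ^ w ℤ.* u)
  same-odd-residue = trans (cong (λ k → dyadicℤ x t q ℤ.+ k ℤ.* u) K≡) (regroup (+ 2 ^ x) (+ oddRes t) q (+ 2 ^ w) u)

carry : Bool → Bool → ℤ
carry true  true  = + 0
carry true  false = + 1
carry false true  = + 1
carry false false = + 2

oddRes-carry : ∀ t t′ → + oddRes t ℤ.+ + 2 ℤ.* + oddRes t′ ≡ + oddRes (not t) ℤ.+ carry t t′ ℤ.* + 4
oddRes-carry true  true  = refl
oddRes-carry true  false = refl
oddRes-carry false true  = refl
oddRes-carry false false = refl

classify-shift-dyadic-half : ∀ m t q t′ q′ →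
  classify (dyadicℤ m t q ℤ.+ + 2 ^ suc m ℤ.* oddℤ t′ q′) ≡ dyadicClass m (not t)
classify-shift-dyadic-half m t q t′ q′ =
  trans (cong classify flipped-odd-residue) (classify-dyadicℤ m (not t) (Q ℤ.+ carry t t′))
  where
  A = + 2 ^ m
  Q = q ℤ.+ q′ ℤ.* + 2
  collect : ∀ A R R′ q q′ → A ℤ.* (R ℤ.+ q ℤ.* + 4) ℤ.+ A ℤ.* + 2 ℤ.* (R′ ℤ.+ q′ ℤ.* + 4)
                          ≡ A ℤ.* ((R ℤ.+ + 2 ℤ.* R′) ℤ.+ (q ℤ.+ q′ ℤ.* + 2) ℤ.* + 4)
  collect = ℤ-Solver.solve-∀
  absorb : ∀ A R C Q → A ℤ.* ((R ℤ.+ C ℤ.* + 4) ℤ.+ Q ℤ.* + 4) ≡ A ℤ.* (R ℤ.+ (Q ℤ.+ C) ℤ.* + 4)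
  absorb = ℤ-Solver.solve-∀
  flipped-odd-residue : dyadicℤ m t q ℤ.+ + 2 ^ suc m ℤ.* oddℤ t′ q′ ≡ dyadicℤ m (not t) (Q ℤ.+ carry t t′)
  flipped-odd-residue = begin
    dyadicℤ m t q ℤ.+ + 2 ^ suc m ℤ.* oddℤ t′ q′
      ≡⟨ cong (λ k → dyadicℤ m t q ℤ.+ k ℤ.* oddℤ t′ q′) (trans (cong +_ (*-comm 2 (2 ^ m))) (ℤ.pos-* (2 ^ m) 2)) ⟩
    A ℤ.* (+ oddRes t ℤ.+ q ℤ.* + 4) ℤ.+ A ℤ.* + 2 ℤ.* (+ oddRes t′ ℤ.+ q′ ℤ.* + 4)
      ≡⟨ collect A (+ oddRes t) (+ oddRes t′) q q′ ⟩
    A ℤ.* ((+ oddRes t ℤ.+ + 2 ℤ.* + oddRes t′) ℤ.+ Q ℤ.* + 4)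
      ≡⟨ cong (λ k → A ℤ.* (k ℤ.+ Q ℤ.* + 4)) (oddRes-carry t t′) ⟩
    A ℤ.* ((+ oddRes (not t) ℤ.+ carry t t′ ℤ.* + 4) ℤ.+ Q ℤ.* + 4)
      ≡⟨ absorb A (+ oddRes (not t)) (carry t t′) Q ⟩
    dyadicℤ m (not t) (Q ℤ.+ carry t t′)
      ∎
    where open ≡-Reasoning

classify-shift-low : ∀ {m} d u → d ≢ 0ℤ → ∣ d ∣ < 2 ^ suc m → ∣ d ∣ ≢ 2 ^ m →
  classify (d ℤ.+ + 2 ^ suc m ℤ.* u) ≡ classify d
classify-shift-low {m} d u d≢0 ∣d∣<2^[1+m] ∣d∣≢2^m
  with x , t , q , ∣d∣≡ ← dyadic-decomposition ∣ d ∣ (n≢0⇒n>0 (d≢0 ∘ ℤ.∣i∣≡0⇒i≡0))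
  with t′ , q′ , refl ← signed-dyadic d x t q ∣d∣≡ =
    trans (classify-shift-dyadic-low t′ q′ u x<m) (sym (classify-dyadicℤ x t′ q′))
  where
  x<m : x < m
  x<m = valuation< x t q (subst (_< _) ∣d∣≡ ∣d∣<2^[1+m]) (subst (_≢ _) ∣d∣≡ ∣d∣≢2^m)

classify-shift-half : ∀ {m} d t′ q′ → ∣ d ∣ ≡ 2 ^ m →
  ∃[ t ] classify d ≡ dyadicClass m t × classify (d ℤ.+ + 2 ^ suc m ℤ.* oddℤ t′ q′) ≡ dyadicClass m (not t)
classify-shift-half {m} d t′ q′ ∣d∣≡2^m
  with t , q , refl ← signed-dyadic d m true 0 (trans ∣d∣≡2^m (sym (*-identityʳ (2 ^ m)))) =
    t , classify-dyadicℤ m t q , classify-shift-dyadic-half m t q t′ q′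

-- Index arithmetic

-- Defs.blockEntry B sel I J unfolds definitionally to
-- entry B (sel (classify (blockOffset I J))) (I mod 4) (J mod 4).
entry : (Fin 4 → Fin 4 → ℤ) → ℤ × ℤ → Fin 4 → Fin 4 → ℤ
entry B (ε , c) r s = ε ℤ.* B r s ℤ.+ (if does (r Fin.≟ s) then c else 0ℤ)

blockOffset : ℕ → ℕ → ℤ
blockOffset I J = + (J / 4) ℤ.- + (I / 4)

/-shift : ∀ J K → (J + K * 4) / 4 ≡ J / 4 + K
/-shift J K = trans (+-distrib-/-∣ʳ J (divides-refl K)) (cong (λ k → J / 4 + k) (m*n/n≡m K 4))

mod-shift : ∀ J K → (J + K * 4) mod 4 ≡ J mod 4
mod-shift J K = fromℕ<-cong _ _ ([m+kn]%n≡m%n J K 4) (m%n<n (J + K * 4) 4) (m%n<n J 4)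

blockOffset-shiftʳ : ∀ I J K → blockOffset I (J + K * 4) ≡ blockOffset I J ℤ.+ + K ℤ.* + 1
blockOffset-shiftʳ I J K rewrite /-shift J K | ℤ.pos-+ (J / 4) K = regroup (+ (J / 4)) (+ (I / 4)) (+ K)
  where
  regroup : ∀ b a k → b ℤ.+ k ℤ.- a ≡ b ℤ.- a ℤ.+ k ℤ.* + 1
  regroup = ℤ-Solver.solve-∀

blockOffset-shiftˡ : ∀ I J K → blockOffset (I + K * 4) J ≡ blockOffset I J ℤ.+ + K ℤ.* ℤ.-1ℤ
blockOffset-shiftˡ I J K rewrite /-shift I K | ℤ.pos-+ (I / 4) K = regroup (+ (J / 4)) (+ (I / 4)) (+ K)
  where
  regroup : ∀ b a k → b ℤ.- (a ℤ.+ k) ≡ b ℤ.- a ℤ.+ k ℤ.* ℤ.-1ℤ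
  regroup = ℤ-Solver.solve-∀

blockOffset-shift : ∀ I J K → blockOffset (I + K * 4) (J + K * 4) ≡ blockOffset I J
blockOffset-shift I J K rewrite /-shift I K | /-shift J K | ℤ.pos-+ (I / 4) K | ℤ.pos-+ (J / 4) K =
  cancel (+ (J / 4)) (+ (I / 4)) (+ K)
  where
  cancel : ∀ b a k → b ℤ.+ k ℤ.- (a ℤ.+ k) ≡ b ℤ.- a
  cancel = ℤ-Solver.solve-∀

∣blockOffset∣< : ∀ {I J K} → I < K * 4 → J < K * 4 → ∣ blockOffset I J ∣ < K
∣blockOffset∣< {I} {J} I< J< = begin-strict
  ∣ blockOffset I J ∣ ≡⟨ cong ∣_∣ (ℤ.m-n≡m⊖n (J / 4) (I / 4)) ⟩
  ∣ J / 4 ⊖ I / 4 ∣   ≤⟨ ℤ.∣m⊝n∣≤m⊔n (J / 4) (I / 4) ⟩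
  J / 4 ⊔ I / 4       <⟨ ⊔-lub (m<n*o⇒m/o<n J<) (m<n*o⇒m/o<n I<) ⟩
  _                   ∎
  where open ≤-Reasoning

+residue+quotient : ∀ I → + I ≡ + Fin.toℕ (I mod 4) ℤ.+ + (I / 4) ℤ.* + 4
+residue+quotient I = begin
  + I                                       ≡⟨ cong +_ (m≡m%n+[m/n]*n I 4) ⟩
  + (I % 4 + I / 4 * 4)                     ≡⟨ cong (λ k → + (k + I / 4 * 4)) (toℕ-fromℕ< (m%n<n I 4)) ⟨
  + (Fin.toℕ (I mod 4) + I / 4 * 4)         ≡⟨ ℤ.pos-+ (Fin.toℕ (I mod 4)) _ ⟩
  + Fin.toℕ (I mod 4) ℤ.+ + (I / 4 * 4)     ≡⟨ cong (λ k → + Fin.toℕ (I mod 4) ℤ.+ k) (ℤ.pos-* (I / 4) 4) ⟩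
  + Fin.toℕ (I mod 4) ℤ.+ + (I / 4) ℤ.* + 4 ∎
  where open ≡-Reasoning

⊖-same-residue : ∀ I J → I mod 4 ≡ J mod 4 → J ⊖ I ≡ blockOffset I J ℤ.* + 4
⊖-same-residue I J r≡s = begin
  J ⊖ I                                                       ≡⟨ ℤ.m-n≡m⊖n J I ⟨
  + J ℤ.- + I                                                 ≡⟨ cong₂ ℤ._-_ (+residue+quotient J) (+residue+quotient I) ⟩
  (R J ℤ.+ + (J / 4) ℤ.* + 4) ℤ.- (R I ℤ.+ + (I / 4) ℤ.* + 4) ≡⟨ cong (λ r → (R J ℤ.+ + (J / 4) ℤ.* + 4) ℤ.- (+ Fin.toℕ r ℤ.+ + (I / 4) ℤ.* + 4)) r≡s ⟩
  (R J ℤ.+ + (J / 4) ℤ.* + 4) ℤ.- (R J ℤ.+ + (I / 4) ℤ.* + 4) ≡⟨ cancel (R J) (+ (J / 4)) (+ (I / 4)) ⟩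
  blockOffset I J ℤ.* + 4                                     ∎
  where
  open ≡-Reasoning
  R : ℕ → ℤ
  R K = + Fin.toℕ (K mod 4)
  cancel : ∀ r b a → (r ℤ.+ b ℤ.* + 4) ℤ.- (r ℤ.+ a ℤ.* + 4) ≡ (b ℤ.- a) ℤ.* + 4
  cancel = ℤ-Solver.solve-∀

∣⊖∣-same-residue : ∀ I J → I mod 4 ≡ J mod 4 → ∣ J ⊖ I ∣ ≡ ∣ blockOffset I J ∣ * 4
∣⊖∣-same-residue I J r≡s = trans (cong ∣_∣ (⊖-same-residue I J r≡s)) (ℤ.abs-* (blockOffset I J) (+ 4))

same-residue-offset≢0 : ∀ {I J} → I mod 4 ≡ J mod 4 → I ≢ J → blockOffset I J ≢ 0ℤ
same-residue-offset≢0 {I} {J} r≡s I≢J d≡0 = I≢J (sym (ℤ.+-injective (ℤ.i-j≡0⇒i≡j (+ J) (+ I) J-I≡0)))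
  where
  J-I≡0 : + J ℤ.- + I ≡ 0ℤ
  J-I≡0 = trans (ℤ.m-n≡m⊖n J I) (trans (⊖-same-residue I J r≡s) (cong (ℤ._* + 4) d≡0))

residue-of-ordered-∣⊖∣≡*4 : ∀ {I J} N → I ≤ J → ∣ I ⊖ J ∣ ≡ N * 4 → I mod 4 ≡ J mod 4
residue-of-ordered-∣⊖∣≡*4 {I} {J} N I≤J eq = sym (trans (cong (_mod 4) J≡I+N*4) (mod-shift I N))
  where
  J≡I+N*4 : J ≡ I + N * 4
  J≡I+N*4 = trans (sym (m+[n∸m]≡n I≤J)) (cong (λ k → I + k) (trans (sym (ℤ.∣⊖∣-≤ I≤J)) eq))

residue-of-∣⊖∣≡*4 : ∀ I J N → ∣ J ⊖ I ∣ ≡ N * 4 → I mod 4 ≡ J mod 4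
residue-of-∣⊖∣≡*4 I J N eq with ≤-total I J
... | inj₁ I≤J = residue-of-ordered-∣⊖∣≡*4 N I≤J (trans (ℤ.∣m⊖n∣≡∣n⊖m∣ I J) eq)
... | inj₂ J≤I = sym (residue-of-ordered-∣⊖∣≡*4 N J≤I eq)

fromIndices : ∀ {p} → (ℕ → ℕ → ℤ) → Fin p → Fin p → ℤ
fromIndices A x y = A (Fin.toℕ x) (Fin.toℕ y)

fromIndices-[,] : ∀ {p} (A : ℕ → ℕ → ℤ) {I J} → I < p → J < p → fromIndices {p} A [ suc I , suc J ] ≡ A I J
fromIndices-[,] {p} A {I} {J} I<p J<p with I ℕ.<? p | J ℕ.<? p
... | yes I<p′ | yes J<p′ = cong₂ A (toℕ-fromℕ< I<p′) (toℕ-fromℕ< J<p′)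
... | no I≮p   | _        = ⊥-elim (I≮p I<p)
... | yes _    | no J≮p   = ⊥-elim (J≮p J<p)

<-lower : ∀ {x I} → I < 2 ^ x → I < 2 ^ suc x
<-lower {x} {I} I< = subst (I <_) (sym (2^[1+x]≡2^x+2^x x)) (<-≤-trans I< (m≤m+n (2 ^ x) (2 ^ x)))

<-upper : ∀ {x I} → I < 2 ^ x → I + 2 ^ x < 2 ^ suc x
<-upper {x} {I} I< = subst (I + 2 ^ x <_) (sym (2^[1+x]≡2^x+2^x x)) (+-monoˡ-< (2 ^ x) I<)

-- Block matrices built from a base block

record BlockLaws (B : Fin 4 → Fin 4 → ℤ) (sel : DiffClass → ℤ × ℤ) : Set where
  field
    zero-diagonal : ∀ r → B r r ≡ 0ℤ
    sign-flip     : ∀ x t → proj₁ (sel (dyadicClass x t)) ≡ proj₁ (sel (dyadicClass x (not t)))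
    diagonal-flip : ∀ x t → proj₂ (sel (dyadicClass x t)) ≡ - proj₂ (sel (dyadicClass x (not t)))
    sign-even     : ∀ x t → proj₁ (sel (dyadicClass (suc x) t)) ≡ proj₁ (sel same)

module BlockMatrix {B sel} (laws : BlockLaws B sel) where
  open BlockLaws laws

  E : ℕ → ℕ → ℤ
  E = blockEntry B sel

  Mat : (n : ℕ) → Fin (2 ^ n) → Fin (2 ^ n) → ℤ
  Mat n = fromIndices E

  coeffs : ℤ → ℤ × ℤ
  coeffs d = sel (classify d)

  entry-offdiag : ∀ {P Q r s} → r ≢ s → proj₁ P ≡ proj₁ Q → entry B P r s ≡ entry B Q r s
  entry-offdiag {r = r} {s} r≢s ε≡ with r Fin.≟ s
  ... | yes r≡s = ⊥-elim (r≢s r≡s)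
  ... | no _    = cong (λ ε → ε ℤ.* B r s ℤ.+ 0ℤ) ε≡

  entry-diag : ∀ P {r s} → r ≡ s → entry B P r s ≡ proj₂ P
  entry-diag (ε , c) {r} refl with r Fin.≟ r
  ... | no r≢r = ⊥-elim (r≢r refl)
  ... | yes _  = begin
    ε ℤ.* B r r ℤ.+ c ≡⟨ cong (λ b → ε ℤ.* b ℤ.+ c) (zero-diagonal r) ⟩
    ε ℤ.* 0ℤ ℤ.+ c    ≡⟨ cong (ℤ._+ c) (ℤ.*-zeroʳ ε) ⟩
    0ℤ ℤ.+ c          ≡⟨ ℤ.+-identityˡ c ⟩
    c                 ∎
    where open ≡-Reasoning

  module _ (m : ℕ) (t′ : Bool) (q′ : ℤ) where
    shifted : ℤ → ℤ
    shifted d = d ℤ.+ + 2 ^ suc m ℤ.* oddℤ t′ q′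

    sign-shift : ∀ d → ∣ d ∣ < 2 ^ suc m → proj₁ (coeffs d) ≡ proj₁ (coeffs (shifted d))
    sign-shift d ∣d∣< with d ℤ.≟ 0ℤ
    ... | yes refl = sym (trans (cong (proj₁ ∘ sel) (classify-pure-shift (suc m) t′ q′)) (sign-even m t′))
    ... | no d≢0 with ∣ d ∣ ≟ 2 ^ m
    ...   | no ∣d∣≢2^m = cong (proj₁ ∘ sel) (sym (classify-shift-low {m} d (oddℤ t′ q′) d≢0 ∣d∣< ∣d∣≢2^m))
    ...   | yes ∣d∣≡2^m with t , d-class , shifted-class ← classify-shift-half d t′ q′ ∣d∣≡2^m = begin
      proj₁ (coeffs d)                    ≡⟨ cong (proj₁ ∘ sel) d-class ⟩
      proj₁ (sel (dyadicClass m t))       ≡⟨ sign-flip m t ⟩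
      proj₁ (sel (dyadicClass m (not t))) ≡⟨ cong (proj₁ ∘ sel) shifted-class ⟨
      proj₁ (coeffs (shifted d))          ∎
      where open ≡-Reasoning

    diagonal-shift-half : ∀ d → ∣ d ∣ ≡ 2 ^ m → proj₂ (coeffs d) ≡ - proj₂ (coeffs (shifted d))
    diagonal-shift-half d ∣d∣≡2^m with t , d-class , shifted-class ← classify-shift-half d t′ q′ ∣d∣≡2^m = begin
      proj₂ (coeffs d)                      ≡⟨ cong (proj₂ ∘ sel) d-class ⟩
      proj₂ (sel (dyadicClass m t))         ≡⟨ diagonal-flip m t ⟩
      - proj₂ (sel (dyadicClass m (not t))) ≡⟨ cong (-_ ∘ proj₂ ∘ sel) shifted-class ⟨
      - proj₂ (coeffs (shifted d))          ∎
      where open ≡-Reasoning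

    -- N is the index distance |j − i|.  The split on r ≟ s goes through a helper: a `with`
    -- would abstract r ≟ s inside the unfolded entries as well.
    folding-entry : ∀ d r s N → ∣ d ∣ < 2 ^ suc m →
      (N ≡ 2 ^ m * 4 → r ≡ s) → (r ≡ s → N ≡ ∣ d ∣ * 4 × d ≢ 0ℤ) →
        (N ≡ 2 ^ m * 4 → entry B (coeffs d) r s ≡ - entry B (coeffs (shifted d)) r s)
      × (N ≢ 2 ^ m * 4 → entry B (coeffs d) r s ≡ entry B (coeffs (shifted d)) r s)
    folding-entry d r s N ∣d∣< aligned distance = by-residue (r Fin.≟ s)
      where
      by-residue : Dec (r ≡ s) →
          (N ≡ 2 ^ m * 4 → entry B (coeffs d) r s ≡ - entry B (coeffs (shifted d)) r s)
        × (N ≢ 2 ^ m * 4 → entry B (coeffs d) r s ≡ entry B (coeffs (shifted d)) r s)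
      by-residue (no r≢s) =
          (λ N≡ → ⊥-elim (r≢s (aligned N≡)))
        , (λ _ → entry-offdiag r≢s (sign-shift d ∣d∣<))
      by-residue (yes r≡s) with N≡ , d≢0 ← distance r≡s | ∣ d ∣ ≟ 2 ^ m
      ... | yes ∣d∣≡2^m =
          (λ _ → begin
            entry B (coeffs d) r s                  ≡⟨ entry-diag (coeffs d) r≡s ⟩
            proj₂ (coeffs d)                        ≡⟨ diagonal-shift-half d ∣d∣≡2^m ⟩
            - proj₂ (coeffs (shifted d))            ≡⟨ cong -_ (entry-diag (coeffs (shifted d)) r≡s) ⟨
            - entry B (coeffs (shifted d)) r s      ∎)
        , (λ N≢ → ⊥-elim (N≢ (trans N≡ (cong (_* 4) ∣d∣≡2^m))))
        where open ≡-Reasoning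
      ... | no ∣d∣≢2^m =
          (λ N≡′ → ⊥-elim (∣d∣≢2^m (*-cancelʳ-≡ _ _ 4 (trans (sym N≡) N≡′))))
        , (λ _ → cong (λ c → entry B (sel c) r s) (sym (classify-shift-low {m} d (oddℤ t′ q′) d≢0 ∣d∣< ∣d∣≢2^m)))

    folding : ∀ {I J I′ J′} → I < 2 ^ suc m * 4 → J < 2 ^ suc m * 4 → I ≢ J →
      I′ mod 4 ≡ I mod 4 → J′ mod 4 ≡ J mod 4 → blockOffset I′ J′ ≡ shifted (blockOffset I J) →
        (∣ J ⊖ I ∣ ≡ 2 ^ m * 4 → E I J ≡ - E I′ J′)
      × (∣ J ⊖ I ∣ ≢ 2 ^ m * 4 → E I J ≡ E I′ J′)
    folding {I} {J} I< J< I≢J r′≡r s′≡s offset′≡ rewrite r′≡r | s′≡s | offset′≡ =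
      folding-entry (blockOffset I J) (I mod 4) (J mod 4) ∣ J ⊖ I ∣ (∣blockOffset∣< I< J<)
        (residue-of-∣⊖∣≡*4 I J (2 ^ m))
        (λ r≡s → ∣⊖∣-same-residue I J r≡s , same-residue-offset≢0 r≡s I≢J)

  E-shift : ∀ I J K → E (I + K * 4) (J + K * 4) ≡ E I J
  E-shift I J K =
    trans (cong (λ d → entry B (coeffs d) ((I + K * 4) mod 4) ((J + K * 4) mod 4)) (blockOffset-shift I J K))
          (cong₂ (entry B (coeffs (blockOffset I J))) (mod-shift I K) (mod-shift J K))

  E-offset-diagonal : ∀ x I →
    (E I (I + 2 ^ x * 4) ≡ proj₂ (sel (dyadicClass x true))) × (E (I + 2 ^ x * 4) I ≡ proj₂ (sel (dyadicClass x false)))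
  E-offset-diagonal x I =
      trans (entry-diag (coeffs (blockOffset I (I + K * 4))) (sym (mod-shift I K)))
            (cong (proj₂ ∘ sel) (classify-from-zero true 0ℤ (blockOffset-shiftʳ I I K)))
    , trans (entry-diag (coeffs (blockOffset (I + K * 4) I)) (mod-shift I K))
            (cong (proj₂ ∘ sel) (classify-from-zero false ℤ.-1ℤ (blockOffset-shiftˡ I I K)))
    where
    K = 2 ^ x
    classify-from-zero : ∀ t q {d} → d ≡ blockOffset I I ℤ.+ + K ℤ.* oddℤ t q → classify d ≡ dyadicClass x t
    classify-from-zero t q d≡ =
      trans (cong classify (trans d≡ (cong (λ z → z ℤ.+ + K ℤ.* oddℤ t q) (ℤ.+-inverseʳ (+ (I / 4))))))
            (classify-pure-shift x t q)

  diagonal-quadrants : ∀ n i j → 3 ≤ n → 1 ≤ i → i ≤ 2 ^ (n ∸ 1) → 1 ≤ j → j ≤ 2 ^ (n ∸ 1) →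
    (Mat (n ∸ 1) [ i , j ] ≡ Mat n [ i , j ]) × (Mat n [ i , j ] ≡ Mat n [ i + 2 ^ (n ∸ 1) , j + 2 ^ (n ∸ 1) ])
  diagonal-quadrants n@(suc (suc (suc k))) (suc I) (suc J) (s≤s (s≤s (s≤s _))) _ I< _ J< =
      trans (fromIndices-[,] E I< J<) (sym (fromIndices-[,] E (<-lower {2 + k} I<) (<-lower {2 + k} J<)))
    , (begin
      Mat n [ suc I , suc J ]            ≡⟨ fromIndices-[,] E (<-lower {2 + k} I<) (<-lower {2 + k} J<) ⟩
      E I J                              ≡⟨ E-shift I J (2 ^ k) ⟨
      E (I + 2 ^ k * 4) (J + 2 ^ k * 4)  ≡⟨ cong (λ h → E (I + h) (J + h)) (2^[2+x]≡2^x*4 k) ⟨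
      E (I + H) (J + H)                  ≡⟨ fromIndices-[,] E (<-upper {2 + k} I<) (<-upper {2 + k} J<) ⟨
      Mat n [ suc I + H , suc J + H ]    ∎)
    where
    open ≡-Reasoning
    H = 2 ^ (2 + k)

  off-diagonal-quadrants : ∀ n i j → 4 ≤ n → 1 ≤ i → i ≤ 2 ^ (n ∸ 1) → 1 ≤ j → j ≤ 2 ^ (n ∸ 1) → i ≢ j →
      (∣ j ⊖ i ∣ ≡ 2 ^ (n ∸ 2) →
        (Mat n [ i , j ] ≡ - Mat n [ i , j + 2 ^ (n ∸ 1) ]) × (Mat n [ i , j ] ≡ - Mat n [ i + 2 ^ (n ∸ 1) , j ]))
    × (∣ j ⊖ i ∣ ≢ 2 ^ (n ∸ 2) →
        (Mat n [ i , j ] ≡ Mat n [ i , j + 2 ^ (n ∸ 1) ]) × (Mat n [ i , j ] ≡ Mat n [ i + 2 ^ (n ∸ 1) , j ]))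
  off-diagonal-quadrants n@(suc (suc (suc (suc m)))) (suc I) (suc J) (s≤s (s≤s (s≤s (s≤s _)))) _ I< _ J< i≢j =
      (λ at-half → let at-half′ = distance at-half in
          trans here (trans (proj₁ columns at-half′) (cong -_ (sym right)))
        , trans here (trans (proj₁ rows at-half′) (cong -_ (sym below))))
    , (λ off-half → let off-half′ = off-half ∘ distance⁻¹ in
          trans here (trans (proj₂ columns off-half′) (sym right))
        , trans here (trans (proj₂ rows off-half′) (sym below)))
    where
    K = 2 ^ suc m
    H = 2 ^ (2 + suc m)
    H≡K*4 : H ≡ K * 4
    H≡K*4 = 2^[2+x]≡2^x*4 (suc m)
    here : Mat n [ suc I , suc J ] ≡ E I J
    here = fromIndices-[,] E (<-lower {2 + suc m} I<) (<-lower {2 + suc m} J<)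
    right : Mat n [ suc I , suc J + H ] ≡ E I (J + K * 4)
    right = trans (fromIndices-[,] E (<-lower {2 + suc m} I<) (<-upper {2 + suc m} J<)) (cong (λ h → E I (J + h)) H≡K*4)
    below : Mat n [ suc I + H , suc J ] ≡ E (I + K * 4) J
    below = trans (fromIndices-[,] E (<-upper {2 + suc m} I<) (<-lower {2 + suc m} J<)) (cong (λ h → E (I + h) J) H≡K*4)
    I<K*4 = subst (I <_) H≡K*4 I<
    J<K*4 = subst (J <_) H≡K*4 J<
    columns = folding m true 0ℤ {I′ = I} {J′ = J + K * 4} I<K*4 J<K*4 (i≢j ∘ cong suc) refl (mod-shift J K) (blockOffset-shiftʳ I J K)
    rows = folding m false ℤ.-1ℤ {I′ = I + K * 4} {J′ = J} I<K*4 J<K*4 (i≢j ∘ cong suc) (mod-shift I K) refl (blockOffset-shiftˡ I J K)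
    distance : ∣ suc J ⊖ suc I ∣ ≡ 2 ^ (2 + m) → ∣ J ⊖ I ∣ ≡ 2 ^ m * 4
    distance eq = trans (cong ∣_∣ (sym (ℤ.[1+m]⊖[1+n]≡m⊖n J I))) (trans eq (2^[2+x]≡2^x*4 m))
    distance⁻¹ : ∣ J ⊖ I ∣ ≡ 2 ^ m * 4 → ∣ suc J ⊖ suc I ∣ ≡ 2 ^ (2 + m)
    distance⁻¹ eq = trans (cong ∣_∣ (ℤ.[1+m]⊖[1+n]≡m⊖n J I)) (trans eq (sym (2^[2+x]≡2^x*4 m)))

  off-diagonal-quadrant-diagonals : ∀ n i → 3 ≤ n → 1 ≤ i → i ≤ 2 ^ (n ∸ 1) →
    (Mat n [ i , i + 2 ^ (n ∸ 1) ] ≡ proj₂ (sel (dyadicClass (n ∸ 3) true))) ×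
    (Mat n [ i + 2 ^ (n ∸ 1) , i ] ≡ proj₂ (sel (dyadicClass (n ∸ 3) false)))
  off-diagonal-quadrant-diagonals (suc (suc (suc k))) (suc I) (s≤s (s≤s (s≤s _))) _ I< =
      trans (fromIndices-[,] E (<-lower {2 + k} I<) (<-upper {2 + k} I<))
            (trans (cong (λ h → E I (I + h)) (2^[2+x]≡2^x*4 k)) (proj₁ (E-offset-diagonal k I)))
    , trans (fromIndices-[,] E (<-upper {2 + k} I<) (<-lower {2 + k} I<))
            (trans (cong (λ h → E (I + h) I) (2^[2+x]≡2^x*4 k)) (proj₂ (E-offset-diagonal k I)))

-- The matrices M_p and M_p*

blockM-laws : BlockLaws M4 blockM
blockM-laws = record
  { zero-diagonal = λ { Fin.zero → refl ; (Fin.suc Fin.zero) → refl ; (Fin.suc (Fin.suc Fin.zero)) → refl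
                      ; (Fin.suc (Fin.suc (Fin.suc Fin.zero))) → refl }
  ; sign-flip     = λ { zero true → refl ; zero false → refl ; (suc _) true → refl ; (suc _) false → refl }
  ; diagonal-flip = λ { zero true → refl ; zero false → refl ; (suc _) true → sym (ℤ.neg-involutive _) ; (suc _) false → refl }
  ; sign-even     = λ { _ true → refl ; _ false → refl }
  }

blockM*-laws : BlockLaws M4* blockM*
blockM*-laws = record
  { zero-diagonal = λ { Fin.zero → refl ; (Fin.suc Fin.zero) → refl ; (Fin.suc (Fin.suc Fin.zero)) → refl
                      ; (Fin.suc (Fin.suc (Fin.suc Fin.zero))) → refl }
  ; sign-flip     = λ { zero true → refl ; zero false → refl ; (suc _) true → refl ; (suc _) false → refl }
  ; diagonal-flip = λ { zero true → refl ; zero false → refl ; (suc _) true → refl ; (suc _) false → sym (ℤ.neg-involutive _) }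
  ; sign-even     = λ { _ true → refl ; _ false → refl }
  }

module Mₚ = BlockMatrix blockM-laws
module Mₚ* = BlockMatrix blockM*-laws

[3+k]+1≡k+4 : ∀ k → 3 + k + 1 ≡ k + 4
[3+k]+1≡k+4 = solve-∀

blockM-diagonal : ∀ n → 3 ≤ n → proj₂ (blockM (dyadicClass (n ∸ 3) true)) ≡ + (n + 1)
blockM-diagonal (suc (suc (suc zero)))    (s≤s (s≤s (s≤s _))) = refl
blockM-diagonal (suc (suc (suc (suc k)))) (s≤s (s≤s (s≤s _))) = cong +_ (sym ([3+k]+1≡k+4 (suc k)))

blockM*-diagonal : ∀ n → 3 ≤ n → proj₂ (blockM* (dyadicClass (n ∸ 3) false)) ≡ + (n + 1)
blockM*-diagonal (suc (suc (suc zero)))    (s≤s (s≤s (s≤s _))) = refl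
blockM*-diagonal (suc (suc (suc (suc k)))) (s≤s (s≤s (s≤s _))) = cong +_ (sym ([3+k]+1≡k+4 (suc k)))

M-off-diagonal-quadrant-diagonals : ∀ n i → 3 ≤ n → 1 ≤ i → i ≤ 2 ^ (n ∸ 1) →
  (M n [ i , i + 2 ^ (n ∸ 1) ] ≡ + (n + 1)) × (M n [ i + 2 ^ (n ∸ 1) , i ] ≡ - + (n + 1))
M-off-diagonal-quadrant-diagonals n i 3≤n 1≤i i≤
  with above , below ← Mₚ.off-diagonal-quadrant-diagonals n i 3≤n 1≤i i≤ =
    trans above (blockM-diagonal n 3≤n)
  , trans below (trans (BlockLaws.diagonal-flip blockM-laws (n ∸ 3) false) (cong -_ (blockM-diagonal n 3≤n)))

M*-off-diagonal-quadrant-diagonals : ∀ n i → 3 ≤ n → 1 ≤ i → i ≤ 2 ^ (n ∸ 1) →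
  (M* n [ i + 2 ^ (n ∸ 1) , i ] ≡ + (n + 1)) × (M* n [ i , i + 2 ^ (n ∸ 1) ] ≡ - + (n + 1))
M*-off-diagonal-quadrant-diagonals n i 3≤n 1≤i i≤
  with above , below ← Mₚ*.off-diagonal-quadrant-diagonals n i 3≤n 1≤i i≤ =
    trans below (blockM*-diagonal n 3≤n)
  , trans above (trans (BlockLaws.diagonal-flip blockM*-laws (n ∸ 3) true) (cong -_ (blockM*-diagonal n 3≤n)))

M₈-off-diagonal-quadrants : ∀ (i j : ℕ) → 1 ≤ i → i ≤ 4 → 1 ≤ j → j ≤ 4 → i ≢ j →
    (M 3 [ i , j ] ≡ - (M 3 [ i , j + 4 ]))
  × (M 3 [ i , j ] ≡ - (M 3 [ i + 4 , j ]))
  × (M* 3 [ i , j ] ≡ - (M* 3 [ i , j + 4 ]))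
  × (M* 3 [ i , j ] ≡ - (M* 3 [ i + 4 , j ]))
M₈-off-diagonal-quadrants (suc (suc (suc (suc (suc _))))) _ _ (s≤s (s≤s (s≤s (s≤s ())))) _ _ _
M₈-off-diagonal-quadrants _ (suc (suc (suc (suc (suc _))))) _ _ _ (s≤s (s≤s (s≤s (s≤s ())))) _
M₈-off-diagonal-quadrants 1 2 _ _ _ _ _ = refl , refl , refl , refl
M₈-off-diagonal-quadrants 1 3 _ _ _ _ _ = refl , refl , refl , refl
M₈-off-diagonal-quadrants 1 4 _ _ _ _ _ = refl , refl , refl , refl
M₈-off-diagonal-quadrants 2 1 _ _ _ _ _ = refl , refl , refl , refl
M₈-off-diagonal-quadrants 2 3 _ _ _ _ _ = refl , refl , refl , refl
M₈-off-diagonal-quadrants 2 4 _ _ _ _ _ = refl , refl , refl , refl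
M₈-off-diagonal-quadrants 3 1 _ _ _ _ _ = refl , refl , refl , refl
M₈-off-diagonal-quadrants 3 2 _ _ _ _ _ = refl , refl , refl , refl
M₈-off-diagonal-quadrants 3 4 _ _ _ _ _ = refl , refl , refl , refl
M₈-off-diagonal-quadrants 4 1 _ _ _ _ _ = refl , refl , refl , refl
M₈-off-diagonal-quadrants 4 2 _ _ _ _ _ = refl , refl , refl , refl
M₈-off-diagonal-quadrants 4 3 _ _ _ _ _ = refl , refl , refl , refl
M₈-off-diagonal-quadrants 1 1 _ _ _ _ i≢j = ⊥-elim (i≢j refl)
M₈-off-diagonal-quadrants 2 2 _ _ _ _ i≢j = ⊥-elim (i≢j refl)
M₈-off-diagonal-quadrants 3 3 _ _ _ _ i≢j = ⊥-elim (i≢j refl)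
M₈-off-diagonal-quadrants 4 4 _ _ _ _ i≢j = ⊥-elim (i≢j refl)

lemma1 :
    (∀ (n i j : ℕ) → 3 ≤ n → 1 ≤ i → i ≤ 2 ^ (n ∸ 1) → 1 ≤ j → j ≤ 2 ^ (n ∸ 1) →
      (M (n ∸ 1) [ i , j ] ≡ M n [ i , j ])
      × (M n [ i , j ] ≡ M n [ i + 2 ^ (n ∸ 1) , j + 2 ^ (n ∸ 1) ])
      × (M* (n ∸ 1) [ i , j ] ≡ M* n [ i , j ])
      × (M* n [ i , j ] ≡ M* n [ i + 2 ^ (n ∸ 1) , j + 2 ^ (n ∸ 1) ]))
    ×
    (∀ (i j : ℕ) → 1 ≤ i → i ≤ 4 → 1 ≤ j → j ≤ 4 → i ≢ j →
      (M 3 [ i , j ] ≡ - (M 3 [ i , j + 4 ]))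
      × (M 3 [ i , j ] ≡ - (M 3 [ i + 4 , j ]))
      × (M* 3 [ i , j ] ≡ - (M* 3 [ i , j + 4 ]))
      × (M* 3 [ i , j ] ≡ - (M* 3 [ i + 4 , j ])))
    ×
    (∀ (n i j : ℕ) → 4 ≤ n → 1 ≤ i → i ≤ 2 ^ (n ∸ 1) → 1 ≤ j → j ≤ 2 ^ (n ∸ 1) → i ≢ j →
      (∣ j ⊖ i ∣ ≡ 2 ^ (n ∸ 2) →
        (M n [ i , j ] ≡ - (M n [ i , j + 2 ^ (n ∸ 1) ]))
        × (M n [ i , j ] ≡ - (M n [ i + 2 ^ (n ∸ 1) , j ]))
        × (M* n [ i , j ] ≡ - (M* n [ i , j + 2 ^ (n ∸ 1) ]))
        × (M* n [ i , j ] ≡ - (M* n [ i + 2 ^ (n ∸ 1) , j ])))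
      ×
      (∣ j ⊖ i ∣ ≢ 2 ^ (n ∸ 2) →
        (M n [ i , j ] ≡ M n [ i , j + 2 ^ (n ∸ 1) ])
        × (M n [ i , j ] ≡ M n [ i + 2 ^ (n ∸ 1) , j ])
        × (M* n [ i , j ] ≡ M* n [ i , j + 2 ^ (n ∸ 1) ])
        × (M* n [ i , j ] ≡ M* n [ i + 2 ^ (n ∸ 1) , j ])))
    ×
    (∀ (n i : ℕ) → 3 ≤ n → 1 ≤ i → i ≤ 2 ^ (n ∸ 1) →
      (M n [ i , i + 2 ^ (n ∸ 1) ] ≡ + (n + 1))
      × (M* n [ i + 2 ^ (n ∸ 1) , i ] ≡ + (n + 1))
      × (M n [ i + 2 ^ (n ∸ 1) , i ] ≡ - + (n + 1))
      × (M* n [ i , i + 2 ^ (n ∸ 1) ] ≡ - + (n + 1)))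
lemma1 =
    (λ n i j 3≤n 1≤i i≤ 1≤j j≤ →
      both (Mₚ.diagonal-quadrants n i j 3≤n 1≤i i≤ 1≤j j≤) (Mₚ*.diagonal-quadrants n i j 3≤n 1≤i i≤ 1≤j j≤))
  , M₈-off-diagonal-quadrants
  , (λ n i j 4≤n 1≤i i≤ 1≤j j≤ i≢j →
      let (halfM , restM)   = Mₚ.off-diagonal-quadrants n i j 4≤n 1≤i i≤ 1≤j j≤ i≢j
          (halfM* , restM*) = Mₚ*.off-diagonal-quadrants n i j 4≤n 1≤i i≤ 1≤j j≤ i≢j
      in (λ at-half → both (halfM at-half) (halfM* at-half)) , (λ off-half → both (restM off-half) (restM* off-half)))
  , (λ n i 3≤n 1≤i i≤ →
      let (M-above , M-below)   = M-off-diagonal-quadrant-diagonals n i 3≤n 1≤i i≤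
          (M*-below , M*-above) = M*-off-diagonal-quadrant-diagonals n i 3≤n 1≤i i≤
      in M-above , M*-below , M-below , M*-above)
  where
  both : ∀ {A B C D : Set} → A × B → C × D → A × B × C × D
  both (a , b) (c , d) = a , b , c , d
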